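{- For equal processing times ($p_j=p$ for all jobs $j$), there exists a $4$-competitive algorithm for non-preemptive semi-online machine minimization.
   Context: Machine minimization with deadlines: each job $j$ of a finite instance has integer release date $r_j$, processing time $p_j$ and deadline $d_j$. A feasible non-preemptive schedule on a given number of identical machines processes each job uninterrupted on a single machine for $p_j$ consecutive time units within $[r_j,d_j]$, each machine processing at most one job at a time. $m$ is the minimum number of machines admitting such a schedule. Semi-online: each job becomes known only at its release date, decisions are made over time, and $m$ is known in advance. An algorithm is $c$-competitive if on every instance it produces a feasible schedule using at most $c\cdot m$ machines. -}

module Defs where

open import Data.Nat using (ℕ; zero; suc; _+_; _*_; _≤_; _<_; _≤?_)
open import Data.Fin using (Fin; zero; suc)
open import Data.List using (List; []; _∷_; length; filter)
open import Data.Maybe using (Maybe; just; nothing)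
open import Data.Product using (_×_; _,_; proj₁; proj₂; Σ)
open import Data.Sum using (_⊎_)
open import Relation.Nullary using (¬_; yes; no)
open import Relation.Binary.PropositionalEquality using (_≡_)
open import Function using (_∘_)

record Job : Set where
  constructor job
  field
    rel  : ℕ
    proc : ℕ
    dl   : ℕ
open Job public

Instance : Set
Instance = List Job

-- An assignment of a job: (machine index , start time).
Assignment : Set
Assignment = ℕ × ℕ

Schedule : Instance → Set
Schedule I = Fin (length I) → Assignment

lookupJob : (I : Instance) → Fin (length I) → Job
lookupJob (j ∷ I) zero    = j
lookupJob (j ∷ I) (suc i) = lookupJob I i

machineOf : (I : Instance) → Schedule I → Fin (length I) → ℕ
machineOf I σ i = proj₁ (σ i)

startOf : (I : Instance) → Schedule I → Fin (length I) → ℕ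
startOf I σ i = proj₂ (σ i)

Feasible : ℕ → (I : Instance) → Schedule I → Set
Feasible k I σ =
    (∀ i → machineOf I σ i < k)
  × (∀ i → rel (lookupJob I i) ≤ startOf I σ i)
  × (∀ i → startOf I σ i + proc (lookupJob I i) ≤ dl (lookupJob I i))
  × (∀ i i' → ¬ (i ≡ i') → machineOf I σ i ≡ machineOf I σ i' →
       (startOf I σ i + proc (lookupJob I i) ≤ startOf I σ i')
     ⊎ (startOf I σ i' + proc (lookupJob I i') ≤ startOf I σ i))

FeasibleOn : ℕ → Instance → Set
FeasibleOn k I = Σ (Schedule I) (Feasible k I)

IsMinMachines : ℕ → Instance → Set
IsMinMachines m I = FeasibleOn m I × (∀ k → FeasibleOn k I → m ≤ k)

EqualProc : ℕ → Instance → Set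
EqualProc p I = ∀ i → proc (lookupJob I i) ≡ p

view : ℕ → Instance → List Job
view t = filter (λ j → rel j ≤? t)

-- What an observer sees at time t of the run of a schedule: for each
-- released job, the job itself and its assignment if it has started by t.
obs : ℕ → (I : Instance) → Schedule I → List (Job × Maybe Assignment)
obs t []      σ = []
obs t (j ∷ I) σ with rel j ≤? t
... | no  _ = obs t I (σ ∘ suc)
... | yes _ = (j , started) ∷ obs t I (σ ∘ suc)
  where
  started : Maybe Assignment
  started with proj₂ (σ zero) ≤? t
  ... | yes _ = just (σ zero)
  ... | no  _ = nothing

-- A deterministic semi-online algorithm: it knows m in advance and
-- produces a schedule, subject to non-anticipation: all decisions taken
-- up to time t (which jobs are started at times ≤ t, when and on which
-- machine) depend only on m and on the jobs released up to time t.
record SemiOnlineAlgorithm : Set where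
  field
    run : (m : ℕ) → (I : Instance) → Schedule I
    nonanticipative : ∀ m t (I I' : Instance) → view t I ≡ view t I' →
      obs t I (run m I) ≡ obs t I' (run m I')
open SemiOnlineAlgorithm public

CompetitiveEqualProc : ℕ → SemiOnlineAlgorithm → Set
CompetitiveEqualProc c A =
  ∀ (p : ℕ) → 1 ≤ p → ∀ (I : Instance) → EqualProc p I →
  ∀ (m : ℕ) → IsMinMachines m I → Feasible (c * m) I (run A m I)

-- Let p be the common processing time and call g = ⌈r/p⌉ the group of a job: [g p, (g+1) p)
-- is the first slot of the p-grid starting at or after its release. A job is alignable if
-- it fits into this slot. Alignable jobs are run at grid points by earliest deadline first
-- on 2m machines; a tight job starts at its release date, on one of m machines reserved
-- for the parity of its group, indexed by its rank among the tight jobs of its group.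
--
-- Tight jobs of group g must run inside [(g-1) p, (g+1) p), where an optimal schedule fits
-- at most m of them, so ranks stay below m; groups of equal parity lie two slots apart.
-- If EDF missed a deadline d of a job of group ρ, let u ≤ ρ be least such that every EDF
-- step in the slots u, …, ρ - 1 runs a job of deadline ≤ d. From slot ρ on the missed job
-- is pending, so this holds up to slot ⌊d/p⌋ - 1; and slot u - 1 had a step with no such
-- job pending, so all these jobs have group ≥ u. With the missed job they are more than
-- 2m (⌊d/p⌋ - u) jobs that must run inside [(u-1) p, d], where m machines fit at most
-- m (⌊d/p⌋ + 1 - u).
--
-- Every decision at time t depends only on jobs released by t: EDF at time t only looks at
-- released jobs, and the rank of a tight job only counts jobs ordered before it, which are
-- released no later.

module Submission where

open import Defs
open import Level using (0ℓ)
open import Data.Bool.Base using (if_then_else_)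
open import Data.Empty using (⊥; ⊥-elim)
open import Data.Fin.Base using (Fin; zero; suc)
import Data.Fin.Properties as Finₚ
open import Data.List.Base using (List; []; _∷_; length; filter)
open import Data.List.Extrema.Nat using (argmin; argmin-all; f[argmin]≤f[⊤]; f[argmin]≤f[xs])
open import Data.List.Membership.Propositional using (_∈_)
open import Data.List.Membership.Propositional.Properties using (∈-filter⁺; ∈-filter⁻)
open import Data.List.Properties using (filter-accept; filter-reject)
import Data.List.Relation.Binary.Lex.Strict as Lex
open Lex using (Lex-<)
import Data.List.Relation.Binary.Pointwise as Pointwise
import Data.List.Relation.Unary.All as All
open import Data.List.Relation.Unary.Any using (here; there)
open import Data.Maybe.Base using (Maybe; just; nothing; maybe′)
import Data.Maybe.Properties as Maybeₚ
open import Data.Nat.Base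
open import Data.Nat.DivMod
open import Data.Nat.Divisibility using (_∣_; _∣?_; divides; n∣m*n)
open import Data.Nat.Properties
open import Data.Nat.Tactic.RingSolver using (solve-∀)
open import Data.Product.Base using (Σ; ∃; _×_; _,_; proj₁; proj₂; swap; map₁)
import Data.Product.Properties as ×ₚ
open import Data.Sum.Base using (_⊎_; inj₁; inj₂)
open import Function.Base using (_∘_)
open import Relation.Binary.Definitions using (DecidableEquality; tri<; tri≈; tri>)
open import Relation.Binary.PropositionalEquality
open import Relation.Nullary
open import Relation.Nullary.Decidable using (decidable-stable)
open import Relation.Unary using (Pred; Decidable; _⊆_)
open import Relation.Unary.Properties using (_∩?_; ∁?)

count : ∀ {N} {P : Pred (Fin N) 0ℓ} → Decidable P → ℕ
count {zero}  P? = 0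
count {suc N} P? = (if does (P? zero) then 1 else 0) + count (P? ∘ suc)

private variable
  N : ℕ
  P Q : Pred (Fin N) 0ℓ

count-mono : (P? : Decidable P) (Q? : Decidable Q) → P ⊆ Q → count P? ≤ count Q?
count-mono {zero}  P? Q? P⊆Q = z≤n
count-mono {suc N} P? Q? P⊆Q with P? zero | Q? zero
... | yes p | yes _ = s≤s (count-mono (P? ∘ suc) (Q? ∘ suc) P⊆Q)
... | yes p | no ¬q = contradiction (P⊆Q p) ¬q
... | no _  | yes _ = m≤n⇒m≤1+n (count-mono (P? ∘ suc) (Q? ∘ suc) P⊆Q)
... | no _  | no _  = count-mono (P? ∘ suc) (Q? ∘ suc) P⊆Q

count-partition : (P? : Decidable P) (Q? : Decidable Q) →
                  count P? ≡ count (P? ∩? Q?) + count (P? ∩? ∁? Q?)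
count-partition {zero}  P? Q? = refl
count-partition {suc N} P? Q? with P? zero | Q? zero
... | yes _ | yes _ = cong suc (count-partition (P? ∘ suc) (Q? ∘ suc))
... | yes _ | no _  = trans (cong suc (count-partition (P? ∘ suc) (Q? ∘ suc))) (sym (+-suc _ _))
... | no _  | yes _ = count-partition (P? ∘ suc) (Q? ∘ suc)
... | no _  | no _  = count-partition (P? ∘ suc) (Q? ∘ suc)

count-pos : (P? : Decidable P) → ∀ i → P i → 0 < count P?
count-pos P? zero p with P? zero
... | yes _ = s≤s z≤n
... | no ¬p = contradiction p ¬p
count-pos P? (suc i) p = ≤-trans (count-pos (P? ∘ suc) i p) (m≤n+m _ _)

count-none : (P? : Decidable P) → (∀ i → ¬ P i) → count P? ≡ 0
count-none {zero}  P? ¬P = refl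
count-none {suc N} P? ¬P with P? zero
... | yes p = contradiction p (¬P zero)
... | no _  = count-none (P? ∘ suc) (¬P ∘ suc)

count-≤1 : (P? : Decidable P) → (∀ i j → P i → P j → i ≡ j) → count P? ≤ 1
count-≤1 {zero}  P? unique = z≤n
count-≤1 {suc N} P? unique with P? zero
... | yes p = ≤-reflexive (cong suc (count-none (P? ∘ suc) λ i q → Finₚ.0≢1+n (unique zero (suc i) p q)))
... | no _  = count-≤1 (P? ∘ suc) λ i j p q → Finₚ.suc-injective (unique (suc i) (suc j) p q)

count-mono-< : (P? : Decidable P) (Q? : Decidable Q) → P ⊆ Q → ∀ i → Q i → ¬ P i → count P? < count Q?
count-mono-< P? Q? P⊆Q i q ¬p = begin-strict
  count P?                                  ≤⟨ count-mono P? (Q? ∩? P?) (λ p → P⊆Q p , p) ⟩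
  count (Q? ∩? P?)                          <⟨ m<m+n _ (count-pos (Q? ∩? ∁? P?) i (q , ¬p)) ⟩
  count (Q? ∩? P?) + count (Q? ∩? ∁? P?)    ≡⟨ count-partition Q? P? ⟨
  count Q?                                  ∎
  where open ≤-Reasoning

module _ {N : ℕ} (p : ℕ) (τ : Fin N → ℕ) where

  Separated : Pred (Fin N) 0ℓ → Set
  Separated P = ∀ i j → P i → P j → i ≢ j → τ i + p ≤ τ j ⊎ τ j + p ≤ τ i

  StartsWithin : ℕ → ℕ → Pred (Fin N) 0ℓ → Set
  StartsWithin a b P = ∀ i → P i → a ≤ τ i × τ i < b

  count-separated-window≤1 : ∀ {P a} (P? : Decidable P) → Separated P →
                             StartsWithin a (a + p) P → count P? ≤ 1
  count-separated-window≤1 {P} P? sep within = count-≤1 P? unique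
    where
    unique : ∀ i j → P i → P j → i ≡ j
    unique i j Pi Pj with i Finₚ.≟ j
    ... | yes i≡j = i≡j
    ... | no i≢j with sep i j Pi Pj i≢j
    ... | inj₁ i<j = contradiction (≤-trans (+-monoˡ-≤ p (proj₁ (within i Pi))) i<j) (<⇒≱ (proj₂ (within j Pj)))
    ... | inj₂ j<i = contradiction (≤-trans (+-monoˡ-≤ p (proj₁ (within j Pj))) j<i) (<⇒≱ (proj₂ (within i Pi)))

  count-separated≤ : ∀ {P a} (P? : Decidable P) → Separated P → ∀ n →
                     StartsWithin a (a + n * p) P → count P? ≤ n
  count-separated≤ {a = a} P? sep zero within =
    ≤-reflexive (count-none P? λ i Pi →
      <⇒≱ (subst (τ i <_) (+-identityʳ a) (proj₂ (within i Pi))) (proj₁ (within i Pi)))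
  count-separated≤ {P} {a} P? sep (suc n) within = begin
    count P?                                ≡⟨ count-partition P? early? ⟩
    count (P? ∩? early?) + count (P? ∩? ∁? early?)
                                            ≤⟨ +-mono-≤ (count-separated≤ (P? ∩? early?) sep∩ n (λ i q → proj₁ (within i (proj₁ q)) , proj₂ q))
                                                        (count-separated-window≤1 (P? ∩? ∁? early?) sep∩ last) ⟩
    n + 1                                   ≡⟨ +-comm n 1 ⟩
    suc n                                   ∎
    where
    open ≤-Reasoning
    early? : Decidable (λ i → τ i < a + n * p)
    early? i = τ i <? a + n * p
    sep∩ : ∀ {Q : Pred (Fin N) 0ℓ} → Separated (λ i → P i × Q i)
    sep∩ i j p q = sep i j (proj₁ p) (proj₁ q)
    last : StartsWithin (a + n * p) (a + n * p + p) (λ i → P i × ¬ τ i < a + n * p)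
    last i (Pi , late) = ≮⇒≥ late , subst (τ i <_) (solve a n p) (proj₂ (within i Pi))
      where
      solve : ∀ a n p → a + suc n * p ≡ a + n * p + p
      solve = solve-∀

module _ {N : ℕ} (p : ℕ) (machine τ : Fin N → ℕ) where

  NonOverlapping : Set
  NonOverlapping = ∀ i j → i ≢ j → machine i ≡ machine j → τ i + p ≤ τ j ⊎ τ j + p ≤ τ i

  count-machines≤ : ∀ {P a} m n (P? : Decidable P) → (∀ i → machine i < m) → NonOverlapping →
                    StartsWithin p τ a (a + n * p) P → count P? ≤ m * n
  count-machines≤ {P} m n P? machine<m disjoint within =
    ≤-trans (count-mono P? (below? m) (λ {i} Pi → Pi , machine<m i)) (onMachinesBelow m)
    where
    below? : ∀ k → Decidable (λ i → P i × machine i < k)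
    below? k = P? ∩? λ i → machine i <? k
    onMachinesBelow : ∀ k → count (below? k) ≤ k * n
    onMachinesBelow zero = ≤-reflexive (count-none (below? 0) λ i ())
    onMachinesBelow (suc k) = begin
      count (below? (suc k))                 ≡⟨ count-partition (below? (suc k)) on? ⟩
      count (below? (suc k) ∩? on?) + count (below? (suc k) ∩? ∁? on?)
                                             ≤⟨ +-mono-≤ onK (≤-trans (count-mono _ (below? k) lower) (onMachinesBelow k)) ⟩
      n + k * n                              ∎
      where
      open ≤-Reasoning
      on? : Decidable (λ i → machine i ≡ k)
      on? i = machine i ≟ k
      onK : count (below? (suc k) ∩? on?) ≤ n
      onK = count-separated≤ p τ (below? (suc k) ∩? on?)
              (λ i j Pi Pj i≢j → disjoint i j i≢j (trans (proj₂ Pi) (sym (proj₂ Pj)))) n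
              (λ i Pi → within i (proj₁ (proj₁ Pi)))
      lower : ∀ {i} → (P i × machine i < suc k) × ¬ machine i ≡ k → P i × machine i < k
      lower ((Pi , <1+k) , ≢k) = Pi , ≤∧≢⇒< (s≤s⁻¹ <1+k) ≢k

m<[1+m/n]*n : ∀ m n .{{_ : NonZero n}} → m < suc (m / n) * n
m<[1+m/n]*n m n = begin-strict
  m                     ≡⟨ m≡m%n+[m/n]*n m n ⟩
  m % n + (m / n) * n   <⟨ +-monoˡ-< ((m / n) * n) (m%n<n m n) ⟩
  n + (m / n) * n       ∎
  where open ≤-Reasoning

[m*n+k]/n≡m : ∀ m n k .{{_ : NonZero n}} → k < n → (m * n + k) / n ≡ m
[m*n+k]/n≡m m n k k<n = begin
  (m * n + k) / n      ≡⟨ +-distrib-/-∣ˡ k (n∣m*n m) ⟩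
  m * n / n + k / n    ≡⟨ cong₂ _+_ (m*n/n≡m m n) (m<n⇒m/n≡0 k<n) ⟩
  m + 0                ≡⟨ +-identityʳ m ⟩
  m                    ∎
  where open ≡-Reasoning

[m*n+k]%n≡k : ∀ m n k .{{_ : NonZero n}} → k < n → (m * n + k) % n ≡ k
[m*n+k]%n≡k m n k k<n = trans (cong (_% n) (+-comm (m * n) k)) (trans ([m+kn]%n≡m%n k m n) (m<n⇒m%n≡m k<n))

*+-injective : ∀ {a b a' b' n} .{{_ : NonZero n}} → b < n → b' < n → a * n + b ≡ a' * n + b' → a ≡ a' × b ≡ b'
*+-injective {a} {b} {a'} {b'} {n} b<n b'<n eq =
  trans (sym ([m*n+k]/n≡m a n b b<n)) (trans (cong (_/ n) eq) ([m*n+k]/n≡m a' n b' b'<n)) ,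
  trans (sym ([m*n+k]%n≡k a n b b<n)) (trans (cong (_% n) eq) ([m*n+k]%n≡k a' n b' b'<n))

[2+n]%2≡n%2 : ∀ n → (2 + n) % 2 ≡ n % 2
[2+n]%2≡n%2 n = trans (cong (_% 2) (+-comm 2 n)) ([m+kn]%n≡m%n n 1 2)

n%2≢[1+n]%2 : ∀ n → n % 2 ≢ suc n % 2
n%2≢[1+n]%2 zero          ()
n%2≢[1+n]%2 (suc zero)    ()
n%2≢[1+n]%2 (suc (suc n)) eq = n%2≢[1+n]%2 n (trans (sym ([2+n]%2≡n%2 n)) (trans eq ([2+n]%2≡n%2 (suc n))))

sameParity⇒2+ : ∀ {g g'} → g < g' → g % 2 ≡ g' % 2 → 2 + g ≤ g'
sameParity⇒2+ {g} g<g' same with m≤n⇒m<n∨m≡n g<g'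
... | inj₁ 1+g<g' = 1+g<g'
... | inj₂ refl   = contradiction same (n%2≢[1+n]%2 g)

∣-separated : ∀ {p a b} → p ∣ a → p ∣ b → a ≢ b → a + p ≤ b ⊎ b + p ≤ a
∣-separated {p} (divides k refl) (divides k' refl) a≢b with <-cmp k k'
... | tri< k<k' _ _ = inj₁ (subst (_≤ k' * p) (+-comm p (k * p)) (*-monoˡ-≤ p k<k'))
... | tri≈ _ refl _ = contradiction refl a≢b
... | tri> _ _ k'<k = inj₂ (subst (_≤ k * p) (+-comm p (k' * p)) (*-monoˡ-≤ p k'<k))

∣-<⇒+≤ : ∀ {p a b} → p ∣ a → p ∣ b → a < b → a + p ≤ b
∣-<⇒+≤ p∣a p∣b a<b with ∣-separated p∣a p∣b (<⇒≢ a<b)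
... | inj₁ a+p≤b = a+p≤b
... | inj₂ b+p≤a = contradiction (≤-trans (m≤m+n _ _) b+p≤a) (<⇒≱ a<b)

m≤[n∸1]+[m∸n]+1 : ∀ m n → m ≤ (n ∸ 1) + (m ∸ n) + 1
m≤[n∸1]+[m∸n]+1 m zero    = m≤m+n m 1
m≤[n∸1]+[m∸n]+1 m (suc n) = ≤-trans (m≤n+m∸n m (suc n)) (≤-reflexive (+-comm 1 (n + (m ∸ suc n))))

module _ {P : Pred ℕ 0ℓ} (P? : Decidable P) where

  ¬allUpTo⇒∃¬ : ∀ {v} → ¬ (∀ {n} → n < v → P n) → ∃ λ n → n < v × ¬ P n
  ¬allUpTo⇒∃¬ {v} ¬all with anyUpTo? (∁? P?) v
  ... | yes witness = witness
  ... | no none     = contradiction (λ {n} n<v → decidable-stable (P? n) λ ¬Pn → none (n , n<v , ¬Pn)) ¬all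

  maximalRunBelow : ∀ ρ → ∃ λ u → u ≤ ρ × (∀ {k} → u ≤ k → k < ρ → P k) × (∀ {u'} → u ≡ suc u' → ¬ P u')
  maximalRunBelow zero    = 0 , ≤-refl , (λ _ ()) , λ ()
  maximalRunBelow (suc ρ) with P? ρ | maximalRunBelow ρ
  ... | no ¬Pρ | _ = suc ρ , ≤-refl , (λ u≤k k<u → contradiction u≤k (<⇒≱ k<u)) , λ { refl → ¬Pρ }
  ... | yes Pρ | u , u≤ρ , holds , boundary = u , m≤n⇒m≤1+n u≤ρ , extend , boundary
    where
    extend : ∀ {k} → u ≤ k → k < suc ρ → P k
    extend {k} u≤k k<1+ρ with m<1+n⇒m<n∨m≡n k<1+ρ
    ... | inj₁ k<ρ  = holds u≤k k<ρ
    ... | inj₂ refl = Pρ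

_∈[_,_⟩ : Maybe ℕ → ℕ → ℕ → Set
nothing ∈[ a , b ⟩ = ⊥
just s  ∈[ a , b ⟩ = a ≤ s × s < b

∈[_,_⟩? : ∀ a b x → Dec (x ∈[ a , b ⟩)
∈[ a , b ⟩? nothing  = no λ ()
∈[ a , b ⟩? (just s) = a ≤? s ×-dec s <? b

∈[,⟩-widen : ∀ {a b b'} x → b ≤ b' → x ∈[ a , b ⟩ → x ∈[ a , b' ⟩
∈[,⟩-widen (just s) b≤b' (a≤s , s<b) = a≤s , <-≤-trans s<b b≤b'

∈[,⟩-later : ∀ {a b c} x → a ≤ b → x ∈[ b , c ⟩ → x ∈[ a , c ⟩ × ¬ x ∈[ a , b ⟩
∈[,⟩-later (just s) a≤b (b≤s , s<c) = (≤-trans a≤b b≤s , s<c) , λ (_ , s<b) → <⇒≱ s<b b≤s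

filter-absorbs : ∀ {A : Set} {P Q : Pred A 0ℓ} (P? : Decidable P) (Q? : Decidable Q) → P ⊆ Q →
                 ∀ xs → filter P? (filter Q? xs) ≡ filter P? xs
filter-absorbs P? Q? P⊆Q [] = refl
filter-absorbs P? Q? P⊆Q (x ∷ xs) with Q? x
... | yes _ with P? x
...   | yes _ = cong (x ∷_) (filter-absorbs P? Q? P⊆Q xs)
...   | no _  = filter-absorbs P? Q? P⊆Q xs
filter-absorbs P? Q? P⊆Q (x ∷ xs) | no ¬q =
  trans (filter-absorbs P? Q? P⊆Q xs) (sym (filter-reject P? (¬q ∘ P⊆Q)))

-- Job keys

_≟ʲ_ : DecidableEquality Job
job r p d ≟ʲ job r' p' d' with r ≟ r' | p ≟ p' | d ≟ d'
... | yes refl | yes refl | yes refl = yes refl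
... | no r≢r'  | _        | _        = no (r≢r' ∘ cong rel)
... | _        | no p≢p'  | _        = no (p≢p' ∘ cong proc)
... | _        | _        | no d≢d'  = no (d≢d' ∘ cong dl)

Key : Set
Key = Job × ℕ

copies : Job → List Job → ℕ
copies j I = length (filter (_≟ʲ j) I)

-- A job is identified by itself and the number of equal jobs after it: this
-- separates equal jobs and is unaffected by removing jobs released later.
copiesAfter : (I : Instance) → Fin (length I) → ℕ
copiesAfter (j ∷ I) zero    = copies j I
copiesAfter (j ∷ I) (suc i) = copiesAfter I i

keyAt : (I : Instance) → Fin (length I) → Key
keyAt I i = lookupJob I i , copiesAfter I i

keys : Instance → List Key
keys []      = []
keys (j ∷ I) = (j , copies j I) ∷ keys I

keyAt∈keys : ∀ I i → keyAt I i ∈ keys I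
keyAt∈keys (j ∷ I) zero    = here refl
keyAt∈keys (j ∷ I) (suc i) = there (keyAt∈keys I i)

∈keys⇒keyAt : ∀ I {κ} → κ ∈ keys I → ∃ λ i → keyAt I i ≡ κ
∈keys⇒keyAt (j ∷ I) (here refl) = zero , refl
∈keys⇒keyAt (j ∷ I) (there κ∈) = let i , eq = ∈keys⇒keyAt I κ∈ in suc i , eq

copies-∷ : ∀ j j' I → copies j' I ≤ copies j' (j ∷ I)
copies-∷ j j' I = byCases (j ≟ʲ j')
  where
  byCases : Dec (j ≡ j') → copies j' I ≤ copies j' (j ∷ I)
  byCases (yes j≡j') = ≤-trans (n≤1+n _) (≤-reflexive (sym (cong length (filter-accept (_≟ʲ j') j≡j'))))
  byCases (no j≢j')  = ≤-reflexive (sym (cong length (filter-reject (_≟ʲ j') j≢j')))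

copiesAfter<copies : ∀ I i → copiesAfter I i < copies (lookupJob I i) I
copiesAfter<copies (j ∷ I) zero    = ≤-reflexive (sym (cong length (filter-accept (_≟ʲ j) refl)))
copiesAfter<copies (j ∷ I) (suc i) = <-≤-trans (copiesAfter<copies I i) (copies-∷ j (lookupJob I i) I)

keyAt-zero≢suc : ∀ j I i → keyAt (j ∷ I) zero ≢ keyAt (j ∷ I) (suc i)
keyAt-zero≢suc j I i eq =
  <⇒≢ (subst (λ j' → copiesAfter I i < copies j' I) (cong proj₁ (sym eq)) (copiesAfter<copies I i)) (cong proj₂ (sym eq))

keyAt-injective : ∀ I {i i'} → keyAt I i ≡ keyAt I i' → i ≡ i'
keyAt-injective (j ∷ I) {zero}  {zero}   eq = refl
keyAt-injective (j ∷ I) {zero}  {suc i'} eq = contradiction eq (keyAt-zero≢suc j I i')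
keyAt-injective (j ∷ I) {suc i} {zero}   eq = contradiction (sym eq) (keyAt-zero≢suc j I i)
keyAt-injective (j ∷ I) {suc i} {suc i'} eq = cong suc (keyAt-injective I eq)

length-filter-keys : ∀ {P : Pred Key 0ℓ} (P? : Decidable P) I → length (filter P? (keys I)) ≡ count (P? ∘ keyAt I)
length-filter-keys P? []      = refl
length-filter-keys P? (j ∷ I) with P? (j , copies j I)
... | yes _ = cong suc (length-filter-keys P? I)
... | no _  = length-filter-keys P? I

Released : ℕ → Pred Key 0ℓ
Released t κ = rel (proj₁ κ) ≤ t

released? : ∀ t → Decidable (Released t)
released? t κ = rel (proj₁ κ) ≤? t

copies-view : ∀ t j I → rel j ≤ t → copies j (view t I) ≡ copies j I
copies-view t j I r = cong length (filter-absorbs (_≟ʲ j) (λ j' → rel j' ≤? t) (λ { refl → r }) I)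

keys-view : ∀ t I → keys (view t I) ≡ filter (released? t) (keys I)
keys-view t [] = refl
keys-view t (j ∷ I) = byCases (rel j ≤? t)
  where
  open ≡-Reasoning
  byCases : Dec (rel j ≤ t) → keys (view t (j ∷ I)) ≡ filter (released? t) (keys (j ∷ I))
  byCases (yes r) = begin
    keys (view t (j ∷ I))                             ≡⟨ cong keys (filter-accept (λ j' → rel j' ≤? t) r) ⟩
    (j , copies j (view t I)) ∷ keys (view t I)       ≡⟨ cong₂ _∷_ (cong (j ,_) (copies-view t j I r)) (keys-view t I) ⟩
    (j , copies j I) ∷ filter (released? t) (keys I)  ≡⟨ filter-accept (released? t) r ⟨
    filter (released? t) (keys (j ∷ I))               ∎
  byCases (no ¬r) = begin
    keys (view t (j ∷ I))                 ≡⟨ cong keys (filter-reject (λ j' → rel j' ≤? t) ¬r) ⟩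
    keys (view t I)                       ≡⟨ keys-view t I ⟩
    filter (released? t) (keys I)         ≡⟨ filter-reject (released? t) ¬r ⟨
    filter (released? t) (keys (j ∷ I))   ∎

_≟ᴷ_ : DecidableEquality Key
_≟ᴷ_ = ×ₚ.≡-dec _≟ʲ_ _≟_

code : Key → List ℕ
code (j , c) = rel j ∷ proc j ∷ dl j ∷ c ∷ []

code-injective : ∀ {κ κ'} → code κ ≡ code κ' → κ ≡ κ'
code-injective {job r p d , c} refl = refl

infix 4 _≺_ _≺?_

_≺_ : Key → Key → Set
κ ≺ κ' = Lex-< _≡_ _<_ (code κ) (code κ')

_≺?_ : ∀ κ κ' → Dec (κ ≺ κ')
κ ≺? κ' = Lex.<-decidable _≟_ _<?_ (code κ) (code κ')

≺-irrefl : ∀ {κ} → ¬ κ ≺ κ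
≺-irrefl {κ} = Lex.<-irreflexive (λ { refl → <-irrefl refl }) (Pointwise.≡⇒Pointwise-≡ {x = code κ} refl)

≺-trans : ∀ {κ κ' κ''} → κ ≺ κ' → κ' ≺ κ'' → κ ≺ κ''
≺-trans = Lex.<-transitive isEquivalence (resp₂ _<_) <-trans

≺-connex : ∀ {κ κ'} → κ ≢ κ' → κ ≺ κ' ⊎ κ' ≺ κ
≺-connex {κ} {κ'} κ≢κ' with Lex.<-compare sym <-cmp (code κ) (code κ')
... | tri< κ≺κ' _ _ = inj₁ κ≺κ'
... | tri≈ _ eq _   = contradiction (code-injective (Pointwise.Pointwise-≡⇒≡ eq)) κ≢κ'
... | tri> _ _ κ'≺κ = inj₂ κ'≺κ

≺⇒rel≤ : ∀ {κ κ'} → κ ≺ κ' → rel (proj₁ κ) ≤ rel (proj₁ κ')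
≺⇒rel≤ (Lex.this r<r') = <⇒≤ r<r'
≺⇒rel≤ (Lex.next refl _) = ≤-refl

-- The algorithm

⌈_/_⌉ : ℕ → ℕ → ℕ
⌈ r / zero  ⌉ = 0
⌈ r / suc q ⌉ = (r + q) / suc q

group : Job → ℕ
group j = ⌈ rel j / proc j ⌉

Alignable : Job → Set
Alignable j = group j * proc j + proc j ≤ dl j

alignable? : ∀ j → Dec (Alignable j)
alignable? j = group j * proc j + proc j ≤? dl j

module _ (j : Job) {q : ℕ} (proc≡ : proc j ≡ suc q) where

  rel≤group*p : rel j ≤ group j * suc q
  rel≤group*p rewrite proc≡ =
    +-cancelʳ-≤ q _ _ (subst (rel j + q ≤_) (+-comm q _) (s≤s⁻¹ (m<[1+m/n]*n (rel j + q) (suc q))))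

  group*p<rel+p : group j * suc q < rel j + suc q
  group*p<rel+p rewrite proc≡ = ≤-<-trans (m/n*n≤m (rel j + q) (suc q)) (+-monoʳ-< (rel j) ≤-refl)

  [group∸1]*p≤rel : (group j ∸ 1) * suc q ≤ rel j
  [group∸1]*p≤rel = begin
    (group j ∸ 1) * suc q          ≡⟨ *-distribʳ-∸ (suc q) (group j) 1 ⟩
    group j * suc q ∸ 1 * suc q    ≤⟨ ∸-monoˡ-≤ (1 * suc q) (<⇒≤ group*p<rel+p) ⟩
    rel j + suc q ∸ 1 * suc q      ≡⟨ cong (rel j + suc q ∸_) (*-identityˡ (suc q)) ⟩
    rel j + suc q ∸ suc q          ≡⟨ m+n∸n≡m (rel j) (suc q) ⟩
    rel j                          ∎
    where open ≤-Reasoning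

  alignable⇒fits : Alignable j → group j * suc q + suc q ≤ dl j
  alignable⇒fits = subst (λ p → group j * p + p ≤ dl j) proc≡

  tight⇒dl< : ¬ Alignable j → dl j < group j * suc q + suc q
  tight⇒dl< tight = ≰⇒> (tight ∘ subst (λ p → group j * p + p ≤ dl j) (sym proc≡))

deadline : Key → ℕ
deadline κ = dl (proj₁ κ)

-- Equal to 2m for m ≥ 1; the successor only keeps it nonzero.
width : ℕ → ℕ
width m = suc (2 * m ∸ 1)

2*m≤width : ∀ m → 2 * m ≤ width m
2*m≤width zero    = z≤n
2*m≤width (suc m) = ≤-refl

width≡2*m : ∀ {m} → 0 < m → width m ≡ 2 * m
width≡2*m {suc m} _ = refl

State : Set
State = List (Key × ℕ)

stepOf : Key → State → Maybe ℕ
stepOf κ []             = nothing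
stepOf κ ((κ' , n) ∷ S) = if does (κ' ≟ᴷ κ) then just n else stepOf κ S

Candidate : ℕ → ℕ → State → Key → Set
Candidate m n S κ =
  Alignable (proj₁ κ) × rel (proj₁ κ) ≤ n / width m × proc (proj₁ κ) ∣ n / width m × stepOf κ S ≡ nothing

candidate? : ∀ m n S → Decidable (Candidate m n S)
candidate? m n S κ =
  alignable? (proj₁ κ) ×-dec rel (proj₁ κ) ≤? n / width m ×-dec proc (proj₁ κ) ∣? n / width m
    ×-dec Maybeₚ.≡-dec _≟_ (stepOf κ S) nothing

earliestDeadline : List Key → Maybe Key
earliestDeadline []       = nothing
earliestDeadline (κ ∷ κs) = just (argmin deadline κ κs)

-- Step n of the simulation takes place at time n / width m and fills machine n % width m.
edf  : ℕ → List Key → ℕ → State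
pick : ℕ → List Key → ℕ → Maybe Key

edf m L zero    = []
edf m L (suc n) = maybe′ (λ κ → (κ , n) ∷ edf m L n) (edf m L n) (pick m L n)

pick m L n = earliestDeadline (filter (candidate? m n (edf m L n)) L)

horizon : ℕ → Key → ℕ
horizon m κ = suc (deadline κ) * width m

fromStep : ℕ → Key → Maybe ℕ → Assignment
fromStep m κ (just n) = 2 * m + n % width m , n / width m
-- Junk for a key EDF never schedules, which the analysis rules out. Starting at the
-- deadline, it is observed only once the simulation up to the horizon is fixed.
fromStep m κ nothing  = 0 , deadline κ

assignAlignable : ℕ → List Key → Key → Assignment
assignAlignable m L κ = fromStep m κ (stepOf κ (edf m L (horizon m κ)))

TightRival : Key → Key → Set
TightRival κ κ' = ¬ Alignable (proj₁ κ') × group (proj₁ κ') ≡ group (proj₁ κ) × κ' ≺ κ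

tightRival? : ∀ κ → Decidable (TightRival κ)
tightRival? κ κ' = ¬? (alignable? (proj₁ κ')) ×-dec group (proj₁ κ') ≟ group (proj₁ κ) ×-dec κ' ≺? κ

rank : List Key → Key → ℕ
rank L κ = length (filter (tightRival? κ) L)

assignTight : ℕ → List Key → Key → Assignment
assignTight m L κ = group (proj₁ κ) % 2 * m + rank L κ , rel (proj₁ κ)

assign : ℕ → List Key → Key → Assignment
assign m L κ with alignable? (proj₁ κ)
... | yes _ = assignAlignable m L κ
... | no _  = assignTight m L κ

assign-alignable : ∀ m L κ → Alignable (proj₁ κ) → assign m L κ ≡ assignAlignable m L κ
assign-alignable m L κ aligned with alignable? (proj₁ κ)
... | yes _     = refl
... | no ¬align = contradiction aligned ¬align

assign-tight : ∀ m L κ → ¬ Alignable (proj₁ κ) → assign m L κ ≡ assignTight m L κ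
assign-tight m L κ tight with alignable? (proj₁ κ)
... | yes aligned = contradiction aligned tight
... | no _        = refl

schedule : (m : ℕ) (I : Instance) → Schedule I
schedule m I i = assign m (keys I) (keyAt I i)

earliestDeadline-∈ : ∀ {κ} xs → earliestDeadline xs ≡ just κ → κ ∈ xs
earliestDeadline-∈ (x ∷ xs) refl = argmin-all deadline (here refl) (All.tabulate there)

earliestDeadline-≤ : ∀ {κ'} xs → κ' ∈ xs → ∃ λ κ → earliestDeadline xs ≡ just κ × deadline κ ≤ deadline κ'
earliestDeadline-≤ (x ∷ xs) (here refl)  = argmin deadline x xs , refl , f[argmin]≤f[⊤] {f = deadline} x xs
earliestDeadline-≤ (x ∷ xs) (there κ'∈) = argmin deadline x xs , refl , All.lookup (f[argmin]≤f[xs] {f = deadline} x xs) κ'∈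

module _ (m : ℕ) (L : List Key) where

  picked-candidate : ∀ {n κ} → pick m L n ≡ just κ → Candidate m n (edf m L n) κ × κ ∈ L
  picked-candidate {n} eq = swap (∈-filter⁻ (candidate? m n (edf m L n)) (earliestDeadline-∈ _ eq))

  picked-unscheduled : ∀ {n κ} → pick m L n ≡ just κ → stepOf κ (edf m L n) ≡ nothing
  picked-unscheduled {n} eq = proj₂ (proj₂ (proj₂ (proj₁ (picked-candidate {n} eq))))

  picked⇒stepOf : ∀ {s κ} → pick m L s ≡ just κ → ∀ n → s < n → stepOf κ (edf m L n) ≡ just s
  picked⇒stepOf {s} {κ} picked (suc n) s<1+n with pick m L n in eq
  ... | nothing with m<1+n⇒m<n∨m≡n s<1+n
  ...   | inj₁ s<n  = picked⇒stepOf picked n s<n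
  ...   | inj₂ refl = contradiction (trans (sym picked) eq) λ ()
  picked⇒stepOf {s} {κ} picked (suc n) s<1+n | just κ' with κ' ≟ᴷ κ | m<1+n⇒m<n∨m≡n s<1+n
  ... | yes refl | inj₁ s<n  = contradiction (trans (sym (picked⇒stepOf picked n s<n)) (picked-unscheduled {n} eq)) λ ()
  ... | yes refl | inj₂ refl = refl
  ... | no κ'≢κ  | inj₁ s<n  = picked⇒stepOf picked n s<n
  ... | no κ'≢κ  | inj₂ refl = contradiction (Maybeₚ.just-injective (trans (sym eq) picked)) κ'≢κ

  stepOf⇒picked : ∀ {s κ} n → stepOf κ (edf m L n) ≡ just s → s < n × pick m L s ≡ just κ
  stepOf⇒picked {s} {κ} (suc n) stepped with pick m L n in eq
  ... | nothing = map₁ m<n⇒m<1+n (stepOf⇒picked n stepped)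
  ... | just κ' with κ' ≟ᴷ κ
  ...   | yes refl = subst (λ s → s < suc n × pick m L s ≡ just κ) (Maybeₚ.just-injective stepped) (≤-refl , eq)
  ...   | no _     = map₁ m<n⇒m<1+n (stepOf⇒picked n stepped)

  stepOf-stable : ∀ {κ s n n'} → stepOf κ (edf m L n) ≡ just s → n ≤ n' → stepOf κ (edf m L n') ≡ just s
  stepOf-stable {n = n} stepped n≤n' with stepOf⇒picked n stepped
  ... | s<n , picked = picked⇒stepOf picked _ (<-≤-trans s<n n≤n')

  unscheduled-antitone : ∀ {κ n n'} → n ≤ n' → stepOf κ (edf m L n') ≡ nothing → stepOf κ (edf m L n) ≡ nothing
  unscheduled-antitone {κ} {n} n≤n' none with stepOf κ (edf m L n) in stepped
  ... | nothing = refl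
  ... | just s  = contradiction (trans (sym none) (stepOf-stable stepped n≤n')) λ ()

  stepOf-injective : ∀ {κ κ' s} n n' → stepOf κ (edf m L n) ≡ just s → stepOf κ' (edf m L n') ≡ just s → κ ≡ κ'
  stepOf-injective n n' stepped stepped' =
    Maybeₚ.just-injective (trans (sym (proj₂ (stepOf⇒picked n stepped))) (proj₂ (stepOf⇒picked n' stepped')))

-- Non-anticipation

module _ (m t : ℕ) (L : List Key) where

  candidate⇒released : ∀ {n S κ} → n < suc t * width m → Candidate m n S κ → Released t κ
  candidate⇒released n< (_ , released , _) = ≤-trans released (s≤s⁻¹ (m<n*o⇒m/o<n n<))

  edf-released  : ∀ n → n ≤ suc t * width m → edf m (filter (released? t) L) n ≡ edf m L n
  pick-released : ∀ n → n < suc t * width m → pick m (filter (released? t) L) n ≡ pick m L n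

  edf-released zero    _  = refl
  edf-released (suc n) n< =
    cong₂ (λ S κ? → maybe′ (λ κ → (κ , n) ∷ S) S κ?) (edf-released n (<⇒≤ n<)) (pick-released n n<)

  pick-released n n< = cong earliestDeadline (begin
    filter (candidate? m n (edf m (filter (released? t) L) n)) (filter (released? t) L)
      ≡⟨ cong (λ S → filter (candidate? m n S) (filter (released? t) L)) (edf-released n (<⇒≤ n<)) ⟩
    filter (candidate? m n (edf m L n)) (filter (released? t) L)
      ≡⟨ filter-absorbs (candidate? m n (edf m L n)) (released? t) (candidate⇒released {S = edf m L n} n<) L ⟩
    filter (candidate? m n (edf m L n)) L ∎)
    where open ≡-Reasoning

AgreeBy : ℕ → Assignment → Assignment → Set
AgreeBy t a b = (proj₂ a ≤ t → a ≡ b) × (proj₂ b ≤ t → a ≡ b)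

assignAlignable-agree : ∀ m t L L' κ → (∀ n → n ≤ suc t * width m → edf m L n ≡ edf m L' n) →
                        proj₂ (assignAlignable m L κ) ≤ t → assignAlignable m L κ ≡ assignAlignable m L' κ
assignAlignable-agree m t L L' κ agree started with stepOf κ (edf m L (horizon m κ)) in stepped
... | just s = cong (fromStep m κ) (sym (stepOf-stable m L' early s<H))
  where
  picked = stepOf⇒picked m L (horizon m κ) stepped
  s<H = proj₁ picked
  early : stepOf κ (edf m L' (suc s)) ≡ just s
  early = trans (cong (stepOf κ) (sym (agree (suc s) (≤-trans (m<[1+m/n]*n s (width m)) (*-monoˡ-≤ (width m) (s≤s started))))))
                (picked⇒stepOf m L (proj₂ picked) (suc s) ≤-refl)
... | nothing = cong (fromStep m κ) (trans (sym stepped) (cong (stepOf κ) (agree (horizon m κ) (*-monoˡ-≤ (width m) (s≤s started)))))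

rank-released : ∀ t L κ → Released t κ → rank (filter (released? t) L) κ ≡ rank L κ
rank-released t L κ r =
  cong length (filter-absorbs (tightRival? κ) (released? t) (λ (_ , _ , κ'≺κ) → ≤-trans (≺⇒rel≤ κ'≺κ) r) L)

assign-released : ∀ m t L κ → Released t κ → AgreeBy t (assign m L κ) (assign m (filter (released? t) L) κ)
assign-released m t L κ r with alignable? (proj₁ κ)
... | yes _ = assignAlignable-agree m t L L' κ agree , sym ∘ assignAlignable-agree m t L' L κ (λ n n≤ → sym (agree n n≤))
  where
  L' = filter (released? t) L
  agree : ∀ n → n ≤ suc t * width m → edf m L n ≡ edf m L' n
  agree n n≤ = sym (edf-released m t L n n≤)
... | no _ = (λ _ → sameTight) , (λ _ → sameTight)
  where
  sameTight = cong (λ k → group (proj₁ κ) % 2 * m + k , rel (proj₁ κ)) (sym (rank-released t L κ r))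

startedBy : ℕ → Assignment → Maybe Assignment
startedBy t a with proj₂ a ≤? t
... | yes _ = just a
... | no _  = nothing

startedBy-agree : ∀ {t a b} → AgreeBy t a b → startedBy t a ≡ startedBy t b
startedBy-agree {t} {a} {b} (a≤t⇒ , b≤t⇒) with proj₂ a ≤? t | proj₂ b ≤? t
... | yes a≤t | yes _   = cong just (a≤t⇒ a≤t)
... | yes a≤t | no b≰t  = contradiction (subst (λ c → proj₂ c ≤ t) (a≤t⇒ a≤t) a≤t) b≰t
... | no a≰t  | yes b≤t = contradiction (subst (λ c → proj₂ c ≤ t) (sym (b≤t⇒ b≤t)) b≤t) a≰t
... | no _    | no _    = refl

obs-released : ∀ {t j I} (σ : Schedule (j ∷ I)) → rel j ≤ t →
               obs t (j ∷ I) σ ≡ (j , startedBy t (σ zero)) ∷ obs t I (σ ∘ suc)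
obs-released {t} {j} σ r with rel j ≤? t
... | no ¬r = contradiction r ¬r
... | yes _ with proj₂ (σ zero) ≤? t
...   | yes _ = refl
...   | no _  = refl

obs-unreleased : ∀ {t j I} (σ : Schedule (j ∷ I)) → ¬ rel j ≤ t → obs t (j ∷ I) σ ≡ obs t I (σ ∘ suc)
obs-unreleased {t} {j} σ ¬r with rel j ≤? t
... | yes r = contradiction r ¬r
... | no _  = refl

obs-view : ∀ t I (g g' : Key → Assignment) → (∀ κ → Released t κ → AgreeBy t (g κ) (g' κ)) →
           obs t I (g ∘ keyAt I) ≡ obs t (view t I) (g' ∘ keyAt (view t I))
obs-view t []      g g' agree = refl
obs-view t (j ∷ I) g g' agree = byCases (rel j ≤? t)
  where
  open ≡-Reasoning
  byCases : Dec (rel j ≤ t) → obs t (j ∷ I) (g ∘ keyAt (j ∷ I)) ≡ obs t (view t (j ∷ I)) (g' ∘ keyAt (view t (j ∷ I)))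
  byCases (yes r) = begin
    obs t (j ∷ I) (g ∘ keyAt (j ∷ I))
      ≡⟨ obs-released (g ∘ keyAt (j ∷ I)) r ⟩
    (j , startedBy t (g (j , copies j I))) ∷ obs t I (g ∘ keyAt I)
      ≡⟨ cong₂ (λ c rest → (j , c) ∷ rest)
               (trans (startedBy-agree (agree _ r)) (cong (λ c → startedBy t (g' (j , c))) (sym (copies-view t j I r))))
               (obs-view t I g g' agree) ⟩
    (j , startedBy t (g' (j , copies j (view t I)))) ∷ obs t (view t I) (g' ∘ keyAt (view t I))
      ≡⟨ obs-released (g' ∘ keyAt (j ∷ view t I)) r ⟨
    obs t (j ∷ view t I) (g' ∘ keyAt (j ∷ view t I))
      ≡⟨ cong (λ V → obs t V (g' ∘ keyAt V)) (filter-accept (λ j' → rel j' ≤? t) r) ⟨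
    obs t (view t (j ∷ I)) (g' ∘ keyAt (view t (j ∷ I))) ∎
  byCases (no ¬r) = begin
    obs t (j ∷ I) (g ∘ keyAt (j ∷ I))
      ≡⟨ obs-unreleased (g ∘ keyAt (j ∷ I)) ¬r ⟩
    obs t I (g ∘ keyAt I)
      ≡⟨ obs-view t I g g' agree ⟩
    obs t (view t I) (g' ∘ keyAt (view t I))
      ≡⟨ cong (λ V → obs t V (g' ∘ keyAt V)) (filter-reject (λ j' → rel j' ≤? t) ¬r) ⟨
    obs t (view t (j ∷ I)) (g' ∘ keyAt (view t (j ∷ I))) ∎

obs-run-view : ∀ m t I → obs t I (schedule m I) ≡ obs t (view t I) (schedule m (view t I))
obs-run-view m t I = obs-view t I (assign m (keys I)) (assign m (keys (view t I)))
  λ κ r → subst (λ L → AgreeBy t (assign m (keys I) κ) (assign m L κ)) (sym (keys-view t I)) (assign-released m t (keys I) κ r)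

algorithm : SemiOnlineAlgorithm
algorithm = record
  { run             = schedule
  ; nonanticipative = λ m t I I' same → begin
      obs t I (schedule m I)                     ≡⟨ obs-run-view m t I ⟩
      obs t (view t I) (schedule m (view t I))   ≡⟨ cong (λ V → obs t V (schedule m V)) same ⟩
      obs t (view t I') (schedule m (view t I')) ≡⟨ obs-run-view m t I' ⟨
      obs t I' (schedule m I')                   ∎
  }
  where open ≡-Reasoning

-- Earliest deadline first on aligned slots

InWindow : ℕ → ℕ → Key → Set
InWindow u D κ = Alignable (proj₁ κ) × u ≤ group (proj₁ κ) × deadline κ ≤ D

inWindow? : ∀ u D → Decidable (InWindow u D)
inWindow? u D κ = alignable? (proj₁ κ) ×-dec u ≤? group (proj₁ κ) ×-dec deadline κ ≤? D

module EDF (m q : ℕ) (I : Instance) (uniform : EqualProc (suc q) I) where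

  p W : ℕ
  p = suc q
  W = width m

  L : List Key
  L = keys I

  proc-key : ∀ {κ} → κ ∈ L → proc (proj₁ κ) ≡ p
  proc-key κ∈ with ∈keys⇒keyAt I κ∈
  ... | i , refl = uniform i

  slotStep : ℕ → ℕ → ℕ
  slotStep k i = k * p * W + i

  slotStep<next : ∀ k {i} → i < W → slotStep k i < suc k * p * W
  slotStep<next k {i} i<W = begin-strict
    k * p * W + i        <⟨ +-monoʳ-< (k * p * W) i<W ⟩
    k * p * W + W        ≤⟨ +-monoʳ-≤ (k * p * W) (m≤m+n W (q * W)) ⟩
    k * p * W + p * W    ≡⟨ solve k p W ⟩
    suc k * p * W        ∎
    where
    open ≤-Reasoning
    solve : ∀ k p W → k * p * W + p * W ≡ suc k * p * W
    solve = solve-∀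

  slotStep-bounds : ∀ {u k V i} → i < W → u * p * W ≤ slotStep k i → slotStep k i < V * p * W → u ≤ k × k < V
  slotStep-bounds {u} {k} {V} {i} i<W lo hi =
    *-cancelʳ-≤ u k p (subst₂ _≤_ (m*n/n≡m (u * p) W) ([m*n+k]/n≡m (k * p) W i i<W) (/-monoˡ-≤ W lo)) ,
    *-cancelʳ-< p k V (*-cancelʳ-< W (k * p) (V * p) (≤-<-trans (m≤m+n (k * p * W) i) hi))

  candidate-in-slot : ∀ {y k i} → y ∈ L → Alignable (proj₁ y) → group (proj₁ y) ≤ k → i < W →
                      stepOf y (edf m L (slotStep k i)) ≡ nothing → Candidate m (slotStep k i) (edf m L (slotStep k i)) y
  candidate-in-slot {y} {k} {i} y∈ aligned group≤k i<W unscheduled rewrite [m*n+k]/n≡m (k * p) W i i<W =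
    aligned ,
    ≤-trans (rel≤group*p (proj₁ y) (proc-key y∈)) (*-monoˡ-≤ p group≤k) ,
    subst (_∣ k * p) (sym (proc-key y∈)) (n∣m*n k) ,
    unscheduled

  GoodStep : ℕ → ℕ → Set
  GoodStep d n = ∃ λ κ → pick m L n ≡ just κ × deadline κ ≤ d

  goodStep? : ∀ d n → Dec (GoodStep d n)
  goodStep? d n with pick m L n
  ... | nothing = no λ ()
  ... | just κ with deadline κ ≤? d
  ...   | yes ≤d = yes (κ , refl , ≤d)
  ...   | no ≰d  = no λ { (_ , refl , ≤d) → ≰d ≤d }

  candidate⇒good : ∀ {y d} n → y ∈ L → Candidate m n (edf m L n) y → deadline y ≤ d → GoodStep d n
  candidate⇒good {y} n y∈ cand y≤d with earliestDeadline-≤ _ (∈-filter⁺ (candidate? m n (edf m L n)) y∈ cand)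
  ... | κ , picked , κ≤y = κ , picked , ≤-trans κ≤y y≤d

  picked-slot : ∀ {s κ} → pick m L s ≡ just κ → s ≡ slotStep (s / W / p) (s % W)
  picked-slot {s} picked with picked-candidate m L {s} picked
  ... | (_ , _ , p∣ , _) , κ∈ = begin
    s                              ≡⟨ m≡m%n+[m/n]*n s W ⟩
    s % W + s / W * W              ≡⟨ +-comm (s % W) _ ⟩
    s / W * W + s % W              ≡⟨ cong (λ t → t * W + s % W) (m/n*n≡m (subst (_∣ s / W) (proc-key κ∈) p∣)) ⟨
    s / W / p * p * W + s % W      ∎
    where open ≡-Reasoning

  ScheduledIn : ℕ → ℕ → ℕ → Fin (length I) → Set
  ScheduledIn N a b i = stepOf (keyAt I i) (edf m L N) ∈[ a , b ⟩

  scheduledIn? : ∀ N a b → Decidable (ScheduledIn N a b)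
  scheduledIn? N a b i = ∈[ a , b ⟩? (stepOf (keyAt I i) (edf m L N))

  count-scheduledIn-widen : ∀ N a {b b'} → b ≤ b' → count (scheduledIn? N a b) ≤ count (scheduledIn? N a b')
  count-scheduledIn-widen N a b≤b' = count-mono (scheduledIn? N a _) (scheduledIn? N a _) (∈[,⟩-widen _ b≤b')

  count-scheduledIn-+ : ∀ N {a b c} → a ≤ b → b ≤ c →
                        count (scheduledIn? N a b) + count (scheduledIn? N b c) ≤ count (scheduledIn? N a c)
  count-scheduledIn-+ N {a} {b} {c} a≤b b≤c = begin
    count (scheduledIn? N a b) + count (scheduledIn? N b c)
      ≤⟨ +-mono-≤ (count-mono _ (ac? ∩? ab?) λ x∈ → ∈[,⟩-widen _ b≤c x∈ , x∈)
                  (count-mono _ (ac? ∩? ∁? ab?) (∈[,⟩-later _ a≤b)) ⟩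
    count (ac? ∩? ab?) + count (ac? ∩? ∁? ab?)
      ≡⟨ count-partition ac? ab? ⟨
    count ac? ∎
    where
    open ≤-Reasoning
    ac? = scheduledIn? N a c
    ab? = scheduledIn? N a b

  busy⇒count : ∀ N a l → a + l ≤ N → (∀ {j} → j < l → ∃ λ κ → pick m L (a + j) ≡ just κ) →
               l ≤ count (scheduledIn? N a (a + l))
  busy⇒count N a zero    _   busy = z≤n
  busy⇒count N a (suc l) a+l<N busy with busy {l} ≤-refl
  ... | y , picked with ∈keys⇒keyAt I (proj₂ (picked-candidate m L {a + l} picked))
  ... | j , refl = begin
    suc l                                              ≡⟨ +-comm 1 l ⟩
    l + 1                                              ≤⟨ +-mono-≤ (busy⇒count N a l (<⇒≤ a+l<N') (busy ∘ m<n⇒m<1+n))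
                                                                  (count-pos _ j new) ⟩
    count (scheduledIn? N a (a + l)) + count (SI ∩? ∁? (scheduledIn? N a (a + l)))
                                                       ≤⟨ +-monoˡ-≤ _ (count-mono _ (SI ∩? _) λ x∈ → widen x∈ , x∈) ⟩
    count (SI ∩? scheduledIn? N a (a + l)) + count (SI ∩? ∁? (scheduledIn? N a (a + l)))
                                                       ≡⟨ count-partition SI (scheduledIn? N a (a + l)) ⟨
    count SI                                           ∎
    where
    open ≤-Reasoning
    SI = scheduledIn? N a (a + suc l)
    a+l<N' : a + l < N
    a+l<N' = subst (_≤ N) (+-suc a l) a+l<N
    widen : ∀ {x} → x ∈[ a , a + l ⟩ → x ∈[ a , a + suc l ⟩
    widen = ∈[,⟩-widen _ (+-monoʳ-≤ a (n≤1+n l))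
    new : ScheduledIn N a (a + suc l) j × ¬ ScheduledIn N a (a + l) j
    new rewrite picked⇒stepOf m L picked N a+l<N' =
      (m≤m+n a l , subst (a + l <_) (sym (+-suc a l)) ≤-refl) , λ (_ , a+l<a+l) → <-irrefl refl a+l<a+l

  DemandBound : Set
  DemandBound = ∀ u D → count (inWindow? u D ∘ keyAt I) ≤ m * (suc (D / p) ∸ u)

  deadlineStep : Key → ℕ
  deadlineStep κ = deadline κ / p * p * W

  module Missed (demand : DemandBound) (i₀ : Fin (length I)) (aligned : Alignable (lookupJob I i₀))
                (missed : stepOf (keyAt I i₀) (edf m L (deadlineStep (keyAt I i₀))) ≡ nothing) where

    κ : Key
    κ = keyAt I i₀

    d V ρ Ns : ℕ
    d  = deadline κ
    V  = d / p
    ρ  = group (proj₁ κ)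
    Ns = V * p * W

    ρ<V : ρ < V
    ρ<V = subst (_≤ V) (m*n/n≡m (suc ρ) p)
            (/-monoˡ-≤ p (subst (_≤ d) (+-comm (ρ * p) p) (alignable⇒fits (proj₁ κ) (uniform i₀) aligned)))

    before-deadline : ∀ {k i} → k < V → i < W → slotStep k i < Ns
    before-deadline {k} k<V i<W = <-≤-trans (slotStep<next k i<W) (*-monoˡ-≤ W (*-monoˡ-≤ p k<V))

    -- From slot ρ on, κ itself is a pending candidate, so no step picks a later deadline.
    late-slot-good : ∀ {k i} → ρ ≤ k → k < V → i < W → GoodStep d (slotStep k i)
    late-slot-good {k} {i} ρ≤k k<V i<W = candidate⇒good (slotStep k i) (keyAt∈keys I i₀)
      (candidate-in-slot (keyAt∈keys I i₀) aligned ρ≤k i<W (unscheduled-antitone m L (<⇒≤ (before-deadline k<V i<W)) missed))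
      ≤-refl

    GoodSlot : ℕ → Set
    GoodSlot k = ∀ {i} → i < W → GoodStep d (slotStep k i)

    goodSlot? : Decidable GoodSlot
    goodSlot? k = allUpTo? (λ i → goodStep? d (slotStep k i)) W

    goodRun : ∃ λ u → u ≤ ρ × (∀ {k} → u ≤ k → k < ρ → GoodSlot k) × (∀ {u'} → u ≡ suc u' → ¬ GoodSlot u')
    goodRun = maximalRunBelow goodSlot? ρ

    u : ℕ
    u = proj₁ goodRun

    u≤V : u ≤ V
    u≤V = ≤-trans (proj₁ (proj₂ goodRun)) (<⇒≤ ρ<V)

    slot-good : ∀ {k i} → u ≤ k → k < V → i < W → GoodStep d (slotStep k i)
    slot-good {k} u≤k k<V i<W with k <? ρ
    ... | yes k<ρ = proj₁ (proj₂ (proj₂ goodRun)) u≤k k<ρ i<W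
    ... | no k≮ρ  = late-slot-good (≮⇒≥ k≮ρ) k<V i<W

    -- Slot u - 1 has a step with no pending job of deadline ≤ d, so every such job
    -- released by then was scheduled before slot u.
    picked-group : ∀ {y s} → pick m L s ≡ just y → u * p * W ≤ s → deadline y ≤ d → u ≤ group (proj₁ y)
    picked-group {y} {s} picked lo y≤d with u ≤? group (proj₁ y)
    ... | yes u≤g = u≤g
    ... | no u≰g  = contradiction good bad
      where
      g<u = ≰⇒> u≰g
      u≡ : u ≡ suc (pred u)
      u≡ = sym (suc-pred u {{>-nonZero (≤-<-trans z≤n g<u)}})
      badStep = ¬allUpTo⇒∃¬ (λ i → goodStep? d (slotStep (pred u) i)) (proj₂ (proj₂ (proj₂ goodRun)) u≡)
      i₁  = proj₁ badStep
      bad = proj₂ (proj₂ badStep)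
      step≤s : slotStep (pred u) i₁ ≤ s
      step≤s = ≤-trans (<⇒≤ (slotStep<next (pred u) (proj₁ (proj₂ badStep)))) (subst (λ v → v * p * W ≤ s) u≡ lo)
      y∈ = proj₂ (picked-candidate m L {s} picked)
      good : GoodStep d (slotStep (pred u) i₁)
      good = candidate⇒good (slotStep (pred u) i₁) y∈
        (candidate-in-slot y∈ (proj₁ (proj₁ (picked-candidate m L {s} picked)))
          (s≤s⁻¹ (subst (group (proj₁ y) <_) u≡ g<u)) (proj₁ (proj₂ badStep))
          (unscheduled-antitone m L step≤s (picked-unscheduled m L {s} picked)))
        y≤d

    scheduled⇒inWindow : ∀ {i} → ScheduledIn Ns (u * p * W) Ns i → InWindow u d (keyAt I i)
    scheduled⇒inWindow {i} scheduled with stepOf (keyAt I i) (edf m L Ns) in stepped | scheduled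
    ... | just s | lo , _ = proj₁ (proj₁ (picked-candidate m L {s} picked)) , picked-group picked lo y≤d , y≤d
      where
      s<Ns×picked = stepOf⇒picked m L Ns stepped
      picked = proj₂ s<Ns×picked
      s≡ = picked-slot picked
      bounds = slotStep-bounds {k = s / W / p} (m%n<n s W) (subst (u * p * W ≤_) s≡ lo) (subst (_< Ns) s≡ (proj₁ s<Ns×picked))
      good : GoodStep d s
      good = subst (GoodStep d) (sym s≡) (slot-good (proj₁ bounds) (proj₂ bounds) (m%n<n s W))
      y≤d : deadline (keyAt I i) ≤ d
      y≤d with good
      ... | _ , picked' , ≤d = subst (λ y → deadline y ≤ d) (Maybeₚ.just-injective (trans (sym picked') picked)) ≤d

    slots-busy : ∀ w → u + w ≤ V → w * W ≤ count (scheduledIn? Ns (u * p * W) ((u + w) * p * W))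
    slots-busy zero    _       = z≤n
    slots-busy (suc w) u+w<V = begin
      suc w * W                                       ≡⟨ +-comm W (w * W) ⟩
      w * W + W                                       ≤⟨ +-mono-≤ (slots-busy w (≤-trans (+-monoʳ-≤ u (n≤1+n w)) u+w<V)) lastSlot ⟩
      count (scheduledIn? Ns a b) + count (scheduledIn? Ns b c)
                                                      ≤⟨ count-scheduledIn-+ Ns (*-monoˡ-≤ W (*-monoˡ-≤ p (m≤m+n u w))) b≤c ⟩
      count (scheduledIn? Ns a c)                     ∎
      where
      open ≤-Reasoning
      a b c : ℕ
      a = u * p * W
      b = (u + w) * p * W
      c = (u + suc w) * p * W
      b+pW≡c : b + p * W ≡ c
      b+pW≡c = solve u w p W
        where
        solve : ∀ u w p W → (u + w) * p * W + p * W ≡ (u + suc w) * p * W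
        solve = solve-∀
      b≤c : b ≤ c
      b≤c = subst (b ≤_) b+pW≡c (m≤m+n b (p * W))
      b+W≤c : b + W ≤ c
      b+W≤c = subst (b + W ≤_) b+pW≡c (+-monoʳ-≤ b (m≤m+n W (q * W)))
      lastSlot : W ≤ count (scheduledIn? Ns b c)
      lastSlot = ≤-trans
        (busy⇒count Ns b W (≤-trans b+W≤c (*-monoˡ-≤ W (*-monoˡ-≤ p u+w<V)))
          λ j<W → let κ , picked , _ = slot-good (m≤m+n u w) (subst (_≤ V) (+-suc u w) u+w<V) j<W in κ , picked)
        (count-scheduledIn-widen Ns b b+W≤c)

    missed-count : (V ∸ u) * W + 1 ≤ count (inWindow? u d ∘ keyAt I)
    missed-count = begin
      (V ∸ u) * W + 1                                   ≡⟨ +-comm _ 1 ⟩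
      suc ((V ∸ u) * W)                                 ≤⟨ s≤s (slots-busy (V ∸ u) (≤-reflexive (m+[n∸m]≡n u≤V))) ⟩
      suc (count (scheduledIn? Ns a ((u + (V ∸ u)) * p * W)))
                                                        ≡⟨ cong (λ v → suc (count (scheduledIn? Ns a (v * p * W)))) (m+[n∸m]≡n u≤V) ⟩
      suc (count (scheduledIn? Ns a Ns))                ≤⟨ count-mono-< (scheduledIn? Ns a Ns) (inWindow? u d ∘ keyAt I) scheduled⇒inWindow
                                                             i₀ (aligned , proj₁ (proj₂ goodRun) , ≤-refl) notScheduled ⟩
      count (inWindow? u d ∘ keyAt I)                   ∎
      where
      open ≤-Reasoning
      a = u * p * W
      notScheduled : ¬ ScheduledIn Ns a Ns i₀
      notScheduled scheduled rewrite missed = scheduled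

    absurd : ⊥
    absurd = <⇒≱ supply>demand (demand u d)
      where
      w = V ∸ u
      1≤w : 1 ≤ w
      1≤w = m<n⇒0<n∸m (≤-<-trans (proj₁ (proj₂ goodRun)) ρ<V)
      supply>demand : m * (suc V ∸ u) < count (inWindow? u d ∘ keyAt I)
      supply>demand = begin-strict
        m * (suc V ∸ u)    ≡⟨ cong (m *_) (+-∸-assoc 1 u≤V) ⟩
        m * suc w          ≡⟨ *-suc m w ⟩
        m + m * w          ≤⟨ +-monoˡ-≤ (m * w) (subst (_≤ m * w) (*-identityʳ m) (*-monoʳ-≤ m 1≤w)) ⟩
        m * w + m * w      ≡⟨ solve m w ⟩
        w * (2 * m)        ≤⟨ *-monoʳ-≤ w (2*m≤width m) ⟩
        w * W              <⟨ m<m+n (w * W) (s≤s z≤n) ⟩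
        w * W + 1          ≤⟨ missed-count ⟩
        count (inWindow? u d ∘ keyAt I) ∎
        where
        open ≤-Reasoning
        solve : ∀ m w → m * w + m * w ≡ w * (2 * m)
        solve = solve-∀

  meetsDeadline : DemandBound → ∀ i → Alignable (lookupJob I i) →
                  ∃ λ s → stepOf (keyAt I i) (edf m L (deadlineStep (keyAt I i))) ≡ just s
  meetsDeadline demand i aligned with stepOf (keyAt I i) (edf m L (deadlineStep (keyAt I i))) in stepped
  ... | just s  = s , refl
  ... | nothing = ⊥-elim (Missed.absurd demand i aligned stepped)

-- Feasibility on 4m machines

module Feasibility (q : ℕ) (I : Instance) (uniform : EqualProc (suc q) I)
                   (m : ℕ) (σ : Schedule I) (feasible : Feasible m I σ) where

  open EDF m q I uniform

  optMachine optStart : Fin (length I) → ℕ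
  optMachine = machineOf I σ
  optStart   = startOf I σ

  jobAt : Fin (length I) → Job
  jobAt = lookupJob I

  optMachine<m : ∀ i → optMachine i < m
  optMachine<m = proj₁ feasible

  rel≤optStart : ∀ i → rel (jobAt i) ≤ optStart i
  rel≤optStart = proj₁ (proj₂ feasible)

  optStart+p≤dl : ∀ i → optStart i + p ≤ dl (jobAt i)
  optStart+p≤dl i = subst (λ p → optStart i + p ≤ dl (jobAt i)) (uniform i) (proj₁ (proj₂ (proj₂ feasible)) i)

  nonOverlapping : NonOverlapping p optMachine optStart
  nonOverlapping i i' i≢i' same =
    subst₂ (λ e e' → optStart i + e ≤ optStart i' ⊎ optStart i' + e' ≤ optStart i) (uniform i) (uniform i')
      (proj₂ (proj₂ (proj₂ feasible)) i i' i≢i' same)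

  demand : DemandBound
  demand u D = count-machines≤ p optMachine optStart m (suc (D / p) ∸ u) (inWindow? u D ∘ keyAt I) optMachine<m nonOverlapping within
    where
    within : StartsWithin p optStart ((u ∸ 1) * p) ((u ∸ 1) * p + (suc (D / p) ∸ u) * p) (InWindow u D ∘ keyAt I)
    within i (_ , u≤g , dl≤D) =
      ≤-trans (*-monoˡ-≤ p (∸-monoˡ-≤ 1 u≤g)) (≤-trans ([group∸1]*p≤rel (jobAt i) (uniform i)) (rel≤optStart i)) ,
      +-cancelʳ-< p (optStart i) _ (begin-strict
        optStart i + p                              ≤⟨ ≤-trans (optStart+p≤dl i) dl≤D ⟩
        D                                           <⟨ m<[1+m/n]*n D p ⟩
        suc (D / p) * p                             ≤⟨ *-monoˡ-≤ p (m≤[n∸1]+[m∸n]+1 (suc (D / p)) u) ⟩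
        ((u ∸ 1) + (suc (D / p) ∸ u) + 1) * p       ≡⟨ solve (u ∸ 1) (suc (D / p) ∸ u) p ⟩
        (u ∸ 1) * p + (suc (D / p) ∸ u) * p + p     ∎)
      where
      open ≤-Reasoning
      solve : ∀ a b p → (a + b + 1) * p ≡ a * p + b * p + p
      solve = solve-∀

  SameTightGroup : Key → Key → Set
  SameTightGroup κ κ' = ¬ Alignable (proj₁ κ') × group (proj₁ κ') ≡ group (proj₁ κ)

  sameTightGroup? : ∀ κ → Decidable (SameTightGroup κ)
  sameTightGroup? κ κ' = ¬? (alignable? (proj₁ κ')) ×-dec group (proj₁ κ') ≟ group (proj₁ κ)

  -- Tight jobs of group g must run inside [(g - 1) p, (g + 1) p), a window too short for two.
  count-sameTightGroup≤m : ∀ κ → count (sameTightGroup? κ ∘ keyAt I) ≤ m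
  count-sameTightGroup≤m κ = subst (count (sameTightGroup? κ ∘ keyAt I) ≤_) (*-identityʳ m)
    (count-machines≤ p optMachine optStart m 1 (sameTightGroup? κ ∘ keyAt I) optMachine<m nonOverlapping within)
    where
    g = group (proj₁ κ)
    within : StartsWithin p optStart ((g ∸ 1) * p) ((g ∸ 1) * p + 1 * p) (SameTightGroup κ ∘ keyAt I)
    within i (tight , same) =
      ≤-trans (subst (λ g → (g ∸ 1) * p ≤ rel (jobAt i)) same ([group∸1]*p≤rel (jobAt i) (uniform i))) (rel≤optStart i) ,
      (begin-strict
        optStart i            <⟨ +-cancelʳ-< p (optStart i) _ (≤-<-trans (optStart+p≤dl i)
                                   (subst (λ g → dl (jobAt i) < g * p + p) same (tight⇒dl< (jobAt i) (uniform i) tight))) ⟩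
        g * p                 ≤⟨ *-monoˡ-≤ p (≤-trans (m≤n+m∸n g 1) (≤-reflexive (+-comm 1 (g ∸ 1)))) ⟩
        (g ∸ 1 + 1) * p       ≡⟨ *-distribʳ-+ p (g ∸ 1) 1 ⟩
        (g ∸ 1) * p + 1 * p   ∎)
      where open ≤-Reasoning

  rank≡count : ∀ κ → rank L κ ≡ count (tightRival? κ ∘ keyAt I)
  rank≡count κ = length-filter-keys (tightRival? κ) I

  rank<m : ∀ i → ¬ Alignable (jobAt i) → rank L (keyAt I i) < m
  rank<m i tight = begin-strict
    rank L (keyAt I i)                            ≡⟨ rank≡count (keyAt I i) ⟩
    count (tightRival? (keyAt I i) ∘ keyAt I)     <⟨ count-mono-< _ (sameTightGroup? (keyAt I i) ∘ keyAt I)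
                                                       (λ (tight' , same , _) → tight' , same) i (tight , refl) (≺-irrefl ∘ proj₂ ∘ proj₂) ⟩
    count (sameTightGroup? (keyAt I i) ∘ keyAt I) ≤⟨ count-sameTightGroup≤m (keyAt I i) ⟩
    m                                             ∎
    where open ≤-Reasoning

  rank-≺ : ∀ i i' → ¬ Alignable (jobAt i) → group (jobAt i) ≡ group (jobAt i') → keyAt I i ≺ keyAt I i' →
           rank L (keyAt I i) < rank L (keyAt I i')
  rank-≺ i i' tight same i≺i' = subst₂ _<_ (sym (rank≡count (keyAt I i))) (sym (rank≡count (keyAt I i')))
    (count-mono-< _ _ (λ (tight'' , same' , ≺i) → tight'' , trans same' same , ≺-trans ≺i i≺i')
                      i (tight , same , i≺i') (≺-irrefl ∘ proj₂ ∘ proj₂))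

  tight-separated : ∀ i i' → group (jobAt i) < group (jobAt i') → group (jobAt i) % 2 ≡ group (jobAt i') % 2 →
                    rel (jobAt i) + p ≤ rel (jobAt i')
  tight-separated i i' g<g' sameParity = <⇒≤ (+-cancelʳ-< p _ _ (begin-strict
    rel (jobAt i) + p + p      ≤⟨ +-monoˡ-≤ p (+-monoˡ-≤ p (rel≤group*p (jobAt i) (uniform i))) ⟩
    g * p + p + p              ≡⟨ solve g p ⟩
    (2 + g) * p                ≤⟨ *-monoˡ-≤ p (sameParity⇒2+ g<g' sameParity) ⟩
    g' * p                     <⟨ group*p<rel+p (jobAt i') (uniform i') ⟩
    rel (jobAt i') + p         ∎))
    where
    open ≤-Reasoning
    g g' : ℕ
    g  = group (jobAt i)
    g' = group (jobAt i')
    solve : ∀ g p → g * p + p + p ≡ (2 + g) * p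
    solve = solve-∀

  data Placement (i : Fin (length I)) : Set where
    aligned : ∀ s → Alignable (jobAt i) → stepOf (keyAt I i) (edf m L (deadlineStep (keyAt I i))) ≡ just s →
              schedule m I i ≡ (2 * m + s % W , s / W) → Placement i
    tight   : ¬ Alignable (jobAt i) → schedule m I i ≡ assignTight m L (keyAt I i) → Placement i

  placement : ∀ i → Placement i
  placement i with alignable? (jobAt i)
  ... | no ¬align = tight ¬align (assign-tight m L (keyAt I i) ¬align)
  ... | yes align with meetsDeadline demand i align
  ...   | s , stepped = aligned s align stepped (trans (assign-alignable m L (keyAt I i) align)
            (cong (fromStep m (keyAt I i)) (stepOf-stable m L {n = deadlineStep (keyAt I i)} stepped beforeHorizon)))
    where
    beforeHorizon : deadlineStep (keyAt I i) ≤ horizon m (keyAt I i)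
    beforeHorizon = *-monoˡ-≤ W (≤-trans (m/n*n≤m (dl (jobAt i)) p) (n≤1+n _))

  module Aligned {i s} (stepped : stepOf (keyAt I i) (edf m L (deadlineStep (keyAt I i))) ≡ just s) where

    early×picked : s < deadlineStep (keyAt I i) × pick m L s ≡ just (keyAt I i)
    early×picked = stepOf⇒picked m L (deadlineStep (keyAt I i)) stepped

    candidate : Candidate m s (edf m L s) (keyAt I i)
    candidate = proj₁ (picked-candidate m L {s} (proj₂ early×picked))

    released : rel (jobAt i) ≤ s / W
    released = proj₁ (proj₂ candidate)

    p∣ : p ∣ s / W
    p∣ = subst (_∣ s / W) (uniform i) (proj₁ (proj₂ (proj₂ candidate)))

    fits : s / W + p ≤ dl (jobAt i)
    fits = ≤-trans (∣-<⇒+≤ p∣ (n∣m*n (dl (jobAt i) / p)) (m<n*o⇒m/o<n (proj₁ early×picked))) (m/n*n≤m (dl (jobAt i)) p)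

  0<m : Fin (length I) → 0 < m
  0<m i = ≤-<-trans z≤n (optMachine<m i)

  tight-machine< : ∀ i → ¬ Alignable (jobAt i) → proj₁ (assignTight m L (keyAt I i)) < 2 * m
  tight-machine< i ¬align = begin-strict
    group (jobAt i) % 2 * m + rank L (keyAt I i)   <⟨ +-mono-≤-< (*-monoˡ-≤ m (s≤s⁻¹ (m%n<n (group (jobAt i)) 2))) (rank<m i ¬align) ⟩
    1 * m + m                                      ≡⟨ solve m ⟩
    2 * m                                          ∎
    where
    open ≤-Reasoning
    solve : ∀ m → 1 * m + m ≡ 2 * m
    solve = solve-∀

  machine<4m : ∀ i → machineOf I (schedule m I) i < 4 * m
  machine<4m i with placement i
  ... | aligned s _ _ placed rewrite placed = begin-strict
    2 * m + s % W    <⟨ +-monoʳ-< (2 * m) (subst (s % W <_) (width≡2*m (0<m i)) (m%n<n s W)) ⟩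
    2 * m + 2 * m    ≡⟨ solve m ⟩
    4 * m            ∎
    where
    open ≤-Reasoning
    solve : ∀ m → 2 * m + 2 * m ≡ 4 * m
    solve = solve-∀
  ... | tight ¬align placed rewrite placed = <-≤-trans (tight-machine< i ¬align) (*-monoˡ-≤ m (s≤s (s≤s (z≤n {2}))))

  released≤start : ∀ i → rel (jobAt i) ≤ startOf I (schedule m I) i
  released≤start i with placement i
  ... | aligned s _ stepped placed rewrite placed = Aligned.released stepped
  ... | tight _ placed rewrite placed = ≤-refl

  start+p≤deadline : ∀ i → startOf I (schedule m I) i + p ≤ dl (jobAt i)
  start+p≤deadline i with placement i
  ... | aligned s _ stepped placed rewrite placed = Aligned.fits stepped
  ... | tight _ placed rewrite placed = ≤-trans (+-monoˡ-≤ p (rel≤optStart i)) (optStart+p≤dl i)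

  aligned-disjoint : ∀ {i i' s s'} → i ≢ i' →
    stepOf (keyAt I i) (edf m L (deadlineStep (keyAt I i))) ≡ just s →
    stepOf (keyAt I i') (edf m L (deadlineStep (keyAt I i'))) ≡ just s' →
    s % W ≡ s' % W → s / W + p ≤ s' / W ⊎ s' / W + p ≤ s / W
  aligned-disjoint {i} {i'} {s} {s'} i≢i' stepped stepped' sameMachine =
    ∣-separated (Aligned.p∣ stepped) (Aligned.p∣ stepped') slots≢
    where
    slots≢ : s / W ≢ s' / W
    slots≢ sameSlot = i≢i' (keyAt-injective I
      (stepOf-injective m L (deadlineStep (keyAt I i)) (deadlineStep (keyAt I i')) stepped (subst (λ x → _ ≡ just x) (sym s≡s') stepped')))
      where
      s≡s' : s ≡ s'
      s≡s' = trans (m≡m%n+[m/n]*n s W) (trans (cong₂ (λ a b → a + b * W) sameMachine sameSlot) (sym (m≡m%n+[m/n]*n s' W)))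

  tight-disjoint : ∀ {i i'} → i ≢ i' → ¬ Alignable (jobAt i) → ¬ Alignable (jobAt i') →
    proj₁ (assignTight m L (keyAt I i)) ≡ proj₁ (assignTight m L (keyAt I i')) →
    rel (jobAt i) + p ≤ rel (jobAt i') ⊎ rel (jobAt i') + p ≤ rel (jobAt i)
  tight-disjoint {i} {i'} i≢i' ¬align ¬align' sameMachine
    with *+-injective {{>-nonZero (0<m i)}} (rank<m i ¬align) (rank<m i' ¬align') sameMachine
  ... | sameParity , sameRank with <-cmp (group (jobAt i)) (group (jobAt i'))
  ...   | tri< g<g' _ _ = inj₁ (tight-separated i i' g<g' sameParity)
  ...   | tri> _ _ g'<g = inj₂ (tight-separated i' i g'<g (sym sameParity))
  ...   | tri≈ _ sameGroup _ with ≺-connex (i≢i' ∘ keyAt-injective I)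
  ...     | inj₁ i≺i' = contradiction sameRank (<⇒≢ (rank-≺ i i' ¬align sameGroup i≺i'))
  ...     | inj₂ i'≺i = contradiction (sym sameRank) (<⇒≢ (rank-≺ i' i ¬align' (sym sameGroup) i'≺i))

  disjoint : NonOverlapping p (machineOf I (schedule m I)) (startOf I (schedule m I))
  disjoint i i' i≢i' sameMachine with placement i | placement i'
  ... | aligned s _ stepped placed | aligned s' _ stepped' placed' rewrite placed | placed' =
    aligned-disjoint i≢i' stepped stepped' (+-cancelˡ-≡ (2 * m) _ _ sameMachine)
  ... | aligned s _ _ placed | tight ¬align' placed' rewrite placed | placed' =
    contradiction (subst (2 * m ≤_) sameMachine (m≤m+n _ _)) (<⇒≱ (tight-machine< i' ¬align'))
  ... | tight ¬align placed | aligned s' _ _ placed' rewrite placed | placed' =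
    contradiction (subst (2 * m ≤_) (sym sameMachine) (m≤m+n _ _)) (<⇒≱ (tight-machine< i ¬align))
  ... | tight ¬align placed | tight ¬align' placed' rewrite placed | placed' =
    tight-disjoint i≢i' ¬align ¬align' sameMachine

  feasible-on-4m : Feasible (4 * m) I (schedule m I)
  feasible-on-4m =
    machine<4m ,
    released≤start ,
    (λ i → subst (λ e → start i + e ≤ dl (jobAt i)) (sym (uniform i)) (start+p≤deadline i)) ,
    λ i i' i≢i' sameMachine → subst₂ (λ e e' → start i + e ≤ start i' ⊎ start i' + e' ≤ start i)
                                (sym (uniform i)) (sym (uniform i')) (disjoint i i' i≢i' sameMachine)
    where
    start = startOf I (schedule m I)

theorem11 : Σ SemiOnlineAlgorithm (CompetitiveEqualProc 4)
theorem11 = algorithm , competitive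
  where
  competitive : CompetitiveEqualProc 4 algorithm
  competitive (suc q) _ I uniform m ((σ , feasible) , _) = Feasibility.feasible-on-4m q I uniform m σ feasible
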